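{- Let $p$ be an odd prime, $m\ge1$, $q=p^m$, and let $\gamma\in GF(q^2)$ with $\gamma^2\ne\bar\gamma^2$. Let $B^1_{(c_1,r_1)}$ and $B^1_{(c_2,r_2)}$ be two distinct circles of the first type in $\mathbb M(q)$, each tangent to both $B^2_{(\gamma,0)}$ and $B^2_{(\bar\gamma,0)}$, with $c_1=\bar c_1$ and $c_2=\bar c_2$. Then $B^1_{(c_1,r_1)}$ and $B^1_{(c_2,r_2)}$ are tangent if and only if $\gamma\bar\gamma$ is a square in $GF(q)$ and \[ c_2=c_1\cdot\frac{2\sqrt{\gamma\bar\gamma}\pm(\gamma+\bar\gamma)}{2\sqrt{\gamma\bar\gamma}\mp(\gamma+\bar\gamma)} \] for one of the two choices of sign, where $\sqrt{\gamma\bar\gamma}$ is a square root of $\gamma\bar\gamma$ in $GF(q)$.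
   Context: $GF(q^2)$ is the quadratic extension of $GF(q)$ and $\bar z:=z^q$. The plane $\mathbb M(q)$ has point set $GF(q^2)\cup\{\infty\}$; its circles are $B^1_{(c,r)}=\{z\in GF(q^2):(z-c)(\bar z-\bar c)=r\}$ ($c\in GF(q^2)$, $r\in GF(q)\setminus\{0\}$; first type) and $B^2_{(c,r)}=\{z\in GF(q^2):\bar c z+c\bar z=r\}\cup\{\infty\}$ ($c\in GF(q^2)\setminus\{0\}$, $r\in GF(q)$; second type). Two distinct circles are tangent if they have exactly one common point. -}

module Defs where

open import Level using (0ℓ)
open import Data.Nat using (ℕ; zero; suc; _^_)
open import Data.Fin using (Fin)
open import Data.Maybe using (Maybe; just; nothing)
open import Data.Product using (Σ; _×_; _,_)
open import Data.Empty using (⊥)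
open import Data.Unit using (⊤)
open import Relation.Binary.PropositionalEquality using (_≡_; _≢_)
open import Relation.Nullary using (¬_)
open import Function.Bundles using (_↔_; _⇔_)
open import Algebra.Structures using (IsCommutativeRing)

-- A finite field with exactly n elements (equality is propositional).
-- GF(q²) is unique up to isomorphism, so we quantify over all such fields.
record FiniteField (n : ℕ) : Set₁ where
  field
    F    : Set
    _+_  : F → F → F
    _*_  : F → F → F
    -_   : F → F
    0#   : F
    1#   : F
    _⁻¹  : F → F
    isCommutativeRing : IsCommutativeRing _≡_ _+_ _*_ -_ 0# 1#
    0≢1  : 0# ≢ 1#
    ⁻¹-inverse : ∀ x → x ≢ 0# → x * (x ⁻¹) ≡ 1#
    enum : F ↔ Fin n

  infixl 7 _*_
  infixl 6 _+_ _-_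

  _-_ : F → F → F
  x - y = x + (- y)

  2# : F
  2# = 1# + 1#

  pow : F → ℕ → F
  pow x zero    = 1#
  pow x (suc k) = x * pow x k

module Plane (q : ℕ) (K : FiniteField (q ^ 2)) where
  open FiniteField K public

  bar : F → F
  bar z = pow z q

  InGFq : F → Set
  InGFq z = bar z ≡ z

  -- points: GF(q²) ∪ {∞}, with ∞ = nothing
  Point : Set
  Point = Maybe F

  PointSet : Set₁
  PointSet = Point → Set

  B¹ : F → F → PointSet
  B¹ c r (just z) = (z - c) * (bar z - bar c) ≡ r
  B¹ c r nothing  = ⊥

  B² : F → F → PointSet
  B² c r (just z) = bar c * z + c * bar z ≡ r
  B² c r nothing  = ⊤

  IsFirstType : F → F → Set
  IsFirstType c r = InGFq r × r ≢ 0#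

  IsSecondType : F → F → Set
  IsSecondType c r = c ≢ 0# × InGFq r

  SameSet : PointSet → PointSet → Set
  SameSet C D = ∀ P → C P ⇔ D P

  Distinct : PointSet → PointSet → Set
  Distinct C D = ¬ SameSet C D

  Tangent : PointSet → PointSet → Set
  Tangent C D = Distinct C D ×
    Σ Point (λ P → (C P × D P) × (∀ Q → C Q → D Q → Q ≡ P))

module Submission where

-- Conjugation z ↦ z̄ = z ^ q is an involutive automorphism of GF(q²) fixing GF(q)
-- (Frobenius in characteristic p together with z ^ (q²) = z). The line B²(γ,0) is
-- {s ω : s ∈ GF(q)} with ω = γ (γ − γ̄), so a circle with real centre c meets it in the
-- roots of a quadratic over GF(q); tangency forces a double root, i.e.
-- 4 γ γ̄ r = c² (γ + γ̄)². Circles with real centres are invariant under conjugation, so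
-- their unique common point z is real; then s = (γ + γ̄) c₁ / 2 (z − c₁) is a square root
-- of γ γ̄ in GF(q), and comparing the two circle equations at z gives
-- c₂ (2 s − (γ + γ̄)) = c₁ (2 s + (γ + γ̄)). Conversely such an s yields the real point
-- z = c₁ + c₁ (γ + γ̄) / 2 s on both circles, and a real common point of two circles with
-- distinct real centres is their only one.

open import Defs
open import Data.Nat using (ℕ; _^_; _≥_)
open import Algebra.Bundles using (CommutativeSemiring)
open import Data.Nat.Primality using (Prime)
open import Relation.Nullary using (¬_)
open import Relation.Binary.PropositionalEquality using (_≡_)

module PrimeDivisibility where

  open import Data.Nat
  open import Data.Nat.Properties
  open import Data.Nat.Divisibility
  open import Data.Nat.DivMod
  open import Data.Nat.Primality
  open import Data.Nat.Combinatorics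
  open import Data.Sum using (inj₁; inj₂)
  open import Data.Empty using (⊥-elim)
  open import Relation.Nullary using (¬_)
  open import Relation.Binary.PropositionalEquality

  prime∤factorial : ∀ {p} → Prime p → ∀ k → k < p → ¬ p ∣ k !
  prime∤factorial {p} p-prime zero _ p∣1 =
    <-irrefl (sym (∣1⇒≡1 p∣1)) (nonTrivial⇒n>1 p {{prime⇒nonTrivial p-prime}})
  prime∤factorial p-prime (suc k) k<p p∣k! with euclidsLemma (suc k) (k !) p-prime p∣k!
  ... | inj₁ p∣1+k = <⇒≱ k<p (∣⇒≤ p∣1+k)
  ... | inj₂ p∣k!′ = prime∤factorial p-prime k (<-trans (n<1+n k) k<p) p∣k!′

  n∣n! : ∀ n .{{_ : NonZero n}} → n ∣ n !
  n∣n! (suc n) = m∣m*n (n !)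

  prime∣binomial : ∀ {p k} → Prime p → 0 < k → k < p → p ∣ p C k
  prime∣binomial {p} {k} p-prime 0<k k<p with euclidsLemma (p C k) (k ! * (p ∸ k) !) p-prime p∣product
    where
    instance
      k!*[p∸k]!≢0 : NonZero (k ! * (p ∸ k) !)
      k!*[p∸k]!≢0 = k !* (p ∸ k) !≢0
    p!≡ : p ! ≡ (p C k) * (k ! * (p ∸ k) !)
    p!≡ = begin
      p !                                         ≡⟨ m/n*n≡m (k![n∸k]!∣n! (<⇒≤ k<p)) ⟨
      p ! / (k ! * (p ∸ k) !) * (k ! * (p ∸ k) !) ≡⟨ cong (_* (k ! * (p ∸ k) !)) (nCk≡n!/k![n-k]! (<⇒≤ k<p)) ⟨
      (p C k) * (k ! * (p ∸ k) !)                 ∎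
      where open ≡-Reasoning
    p∣product : p ∣ (p C k) * (k ! * (p ∸ k) !)
    p∣product = subst (p ∣_) p!≡ (n∣n! p {{prime⇒nonZero p-prime}})
  ... | inj₁ p∣pCk = p∣pCk
  ... | inj₂ p∣denominator with euclidsLemma (k !) ((p ∸ k) !) p-prime p∣denominator
  ...   | inj₁ p∣k! = ⊥-elim (prime∤factorial p-prime k k<p p∣k!)
  ...   | inj₂ p∣[p∸k]! = ⊥-elim (prime∤factorial p-prime (p ∸ k) (∸-monoʳ-< 0<k (<⇒≤ k<p)) p∣[p∸k]!)

  odd-prime : ∀ {p} → Prime p → p ≢ 2 → p ≡ 1 + (p / 2) * 2
  odd-prime {p} p-prime p≢2 with p % 2 in p%2≡ | m%n<n p 2
  ... | 0 | _ with prime⇒irreducible p-prime (m%n≡0⇒n∣m p 2 p%2≡)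
  ...   | inj₁ ()
  ...   | inj₂ 2≡p = ⊥-elim (p≢2 (sym 2≡p))
  odd-prime {p} _ _ | 1 | _ = trans (m≡m%n+[m/n]*n p 2) (cong (_+ (p / 2) * 2) p%2≡)
  odd-prime _ _ | suc (suc _) | s≤s (s≤s ())

module Frobenius {c ℓ} (R : CommutativeSemiring c ℓ) where

  open import Data.Nat as ℕ using (suc; _<_; z<s; s<s)
  import Data.Nat.Properties as ℕ
  open import Data.Nat.Divisibility using (_∣_; divides)
  open import Data.Nat.Primality using (Prime)
  open import Data.Nat.Combinatorics using (_C_; nCn≡1)
  open PrimeDivisibility using (prime∣binomial)
  open import Data.Fin as Fin using (Fin; toℕ; fromℕ; inject₁)
  import Data.Fin.Properties as Fin
  import Relation.Binary.PropositionalEquality as ≡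
  open CommutativeSemiring R
  open import Algebra.Properties.Semiring.Exp semiring
    using (^-congˡ; ^-assocʳ) renaming (_^_ to _^ᴿ_)
  open import Algebra.Properties.Semiring.Mult semiring
    using (_×_; ×-homo-1; ×-assoc-*; ×-congʳ; ×1-homo-*)
  open import Algebra.Properties.Semiring.Sum semiring
    using (sum; sum-init-last; sum-cong-≋; sum-replicate-zero)
  open import Algebra.Properties.CommutativeSemiring.Binomial R
    using (theorem; binomialTerm)
  open import Relation.Binary.Reasoning.Setoid setoid

  binomial-without-middle-terms : ∀ n →
    (∀ k z → 0 < k → k < suc n → (suc n C k) × z ≈ 0#) →
    ∀ x y → (x + y) ^ᴿ suc n ≈ x ^ᴿ suc n + y ^ᴿ suc n
  binomial-without-middle-terms n middle≈0 x y = begin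
    (x + y) ^ᴿ suc n                                   ≈⟨ theorem (suc n) x y ⟩
    t Fin.zero + sum (λ i → t (Fin.suc i))             ≈⟨ +-congˡ (sum-init-last (λ i → t (Fin.suc i))) ⟩
    t Fin.zero + (sum (λ i → t (Fin.suc (inject₁ i))) + t (fromℕ (suc n)))
      ≈⟨ +-congˡ (+-congʳ (trans (sum-cong-≋ middle) (sum-replicate-zero n))) ⟩
    t Fin.zero + (0# + t (fromℕ (suc n)))              ≈⟨ +-cong first (+-identityˡ _) ⟩
    y ^ᴿ suc n + t (fromℕ (suc n))                      ≈⟨ +-comm _ _ ⟩
    t (fromℕ (suc n)) + y ^ᴿ suc n                      ≈⟨ +-congʳ last ⟩
    x ^ᴿ suc n + y ^ᴿ suc n                            ∎
    where
    t : Fin (suc (suc n)) → Carrier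
    t = binomialTerm x y (suc n)
    first : t Fin.zero ≈ y ^ᴿ suc n
    first = trans (×-homo-1 _) (*-identityˡ _)
    last : t (fromℕ (suc n)) ≈ x ^ᴿ suc n
    last = begin
      (suc n C toℕ (fromℕ (suc n))) × (x ^ᴿ toℕ (fromℕ (suc n)) * y ^ᴿ (suc n ℕ.∸ toℕ (fromℕ (suc n))))
        ≡⟨ ≡.cong (λ k → (suc n C k) × (x ^ᴿ k * y ^ᴿ (suc n ℕ.∸ k))) (Fin.toℕ-fromℕ (suc n)) ⟩
      (suc n C suc n) × (x ^ᴿ suc n * y ^ᴿ (suc n ℕ.∸ suc n))
        ≡⟨ ≡.cong₂ (λ c k → c × (x ^ᴿ suc n * y ^ᴿ k)) (nCn≡1 (suc n)) (ℕ.n∸n≡0 n) ⟩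
      1 × (x ^ᴿ suc n * 1#)                             ≈⟨ ×-homo-1 _ ⟩
      x ^ᴿ suc n * 1#                                   ≈⟨ *-identityʳ _ ⟩
      x ^ᴿ suc n                                        ∎
    middle : ∀ i → t (Fin.suc (inject₁ i)) ≈ 0#
    middle i = middle≈0 _ _ z<s (s<s (≡.subst (_< n) (≡.sym (Fin.toℕ-inject₁ i)) (Fin.toℕ<n i)))

  multiple-of-char-vanishes : ∀ {p k} → p × 1# ≈ 0# → ∀ z → p ∣ k → k × z ≈ 0#
  multiple-of-char-vanishes {p} char-p z (divides m ≡.refl) = begin
    (m ℕ.* p) × z               ≈⟨ ×-congʳ (m ℕ.* p) (*-identityˡ z) ⟨
    (m ℕ.* p) × (1# * z)        ≈⟨ ×-assoc-* (m ℕ.* p) 1# z ⟨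
    ((m ℕ.* p) × 1#) * z        ≈⟨ *-congʳ (×1-homo-* m p) ⟩
    ((m × 1#) * (p × 1#)) * z   ≈⟨ *-congʳ (trans (*-congˡ char-p) (zeroʳ _)) ⟩
    0# * z                      ≈⟨ zeroˡ z ⟩
    0#                          ∎

  frobenius : ∀ {p} → Prime p → p × 1# ≈ 0# → ∀ x y → (x + y) ^ᴿ p ≈ x ^ᴿ p + y ^ᴿ p
  frobenius {suc n} p-prime char-p = binomial-without-middle-terms n
    (λ k z 0<k k<p → multiple-of-char-vanishes char-p z (prime∣binomial p-prime 0<k k<p))

  frobenius-iterated : ∀ {p} → Prime p → p × 1# ≈ 0# →
    ∀ k x y → (x + y) ^ᴿ (p ^ k) ≈ x ^ᴿ (p ^ k) + y ^ᴿ (p ^ k)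
  frobenius-iterated p-prime char-p ℕ.zero x y =
    trans (*-identityʳ _) (sym (+-cong (*-identityʳ x) (*-identityʳ y)))
  frobenius-iterated {p} p-prime char-p (suc k) x y = begin
    (x + y) ^ᴿ (p ℕ.* p ^ k)                  ≈⟨ ^-assocʳ (x + y) p (p ^ k) ⟨
    ((x + y) ^ᴿ p) ^ᴿ (p ^ k)                 ≈⟨ ^-congˡ (p ^ k) (frobenius p-prime char-p x y) ⟩
    (x ^ᴿ p + y ^ᴿ p) ^ᴿ (p ^ k)              ≈⟨ frobenius-iterated p-prime char-p k _ _ ⟩
    (x ^ᴿ p) ^ᴿ (p ^ k) + (y ^ᴿ p) ^ᴿ (p ^ k) ≈⟨ +-cong (^-assocʳ x p (p ^ k)) (^-assocʳ y p (p ^ k)) ⟩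
    x ^ᴿ (p ℕ.* p ^ k) + y ^ᴿ (p ℕ.* p ^ k)   ∎

module FiniteFieldSolver {n : ℕ} (K : FiniteField n) where

  open import Level using (0ℓ)
  open import Data.Nat as ℕ using (zero; suc)
  import Data.Nat.Properties as ℕ
  open import Data.Integer as ℤ using (ℤ; -[1+_]; _⊖_; sign; ∣_∣; _◃_)
  import Data.Integer.Properties as ℤ
  open import Data.Sign as Sign using (Sign)
  open import Data.Maybe using (Maybe; just; nothing)
  open import Relation.Nullary using (yes; no)
  open import Relation.Binary.PropositionalEquality
  open import Algebra.Bundles using (CommutativeRing)
  open import Algebra.Structures using (IsCommutativeRing)
  open import Algebra.Solver.Ring.AlmostCommutativeRing
    using (AlmostCommutativeRing; fromCommutativeRing; _-Raw-AlmostCommutative⟶_)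
  import Algebra.Solver.Ring as Solver

  open FiniteField K public
  open IsCommutativeRing isCommutativeRing public
    using (+-assoc; +-comm; *-assoc; *-comm; +-identityˡ; +-identityʳ;
           *-identityˡ; *-identityʳ; -‿inverseˡ; -‿inverseʳ; zeroˡ; zeroʳ)

  commutativeRing : CommutativeRing 0ℓ 0ℓ
  commutativeRing = record { isCommutativeRing = isCommutativeRing }

  open CommutativeRing commutativeRing public
    using (semiring; commutativeSemiring; +-commutativeMonoid; *-commutativeMonoid)
  open import Algebra.Properties.Ring (CommutativeRing.ring commutativeRing) public
    using (-‿involutive; -0#≈0#; -‿anti-homo-+; -‿distribˡ-*; -‿distribʳ-*;
           x∙y⁻¹≈ε⇒x≈y; x≈y⇒x∙y⁻¹≈ε; +-cancelˡ;
           x+x≈x⇒x≈0; +-inverseˡ-unique)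
  open import Algebra.Properties.Semiring.Mult.TCOptimised semiring
    using (×-homo-+; ×1-homo-*) renaming (_×_ to _×′_)

  -- With the optimised ×′ the coefficient ℤ.+ 2 evaluates to 1# + 1#, which is 2# by
  -- definition, so solver goals may mention 2#.
  ⟦_⟧ℤ : ℤ → F
  ⟦ ℤ.+ k ⟧ℤ      = k ×′ 1#
  ⟦ -[1+ k ] ⟧ℤ = - (suc k ×′ 1#)

  private
    ×′-suc : ∀ k → suc k ×′ 1# ≡ 1# + k ×′ 1#
    ×′-suc = ×-homo-+ 1# 1

    1+-cancel : ∀ a b → (1# + a) - (1# + b) ≡ a - b
    1+-cancel a b = begin
      (1# + a) + - (1# + b)      ≡⟨ cong₂ _+_ (+-comm 1# a) (trans (-‿anti-homo-+ 1# b) (+-comm (- b) (- 1#))) ⟩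
      (a + 1#) + (- 1# + - b)    ≡⟨ +-assoc a 1# _ ⟩
      a + (1# + (- 1# + - b))    ≡⟨ cong (a +_) (sym (+-assoc 1# (- 1#) (- b))) ⟩
      a + ((1# - 1#) + - b)      ≡⟨ cong (λ u → a + (u + - b)) (-‿inverseʳ 1#) ⟩
      a + (0# + - b)             ≡⟨ cong (a +_) (+-identityˡ (- b)) ⟩
      a - b                      ∎
      where open ≡-Reasoning

    ⊖-homo : ∀ a b → ⟦ a ⊖ b ⟧ℤ ≡ a ×′ 1# - b ×′ 1#
    ⊖-homo a       zero    = sym (trans (cong ((a ×′ 1#) +_) -0#≈0#) (+-identityʳ _))
    ⊖-homo zero    (suc b) = sym (+-identityˡ _)
    ⊖-homo (suc a) (suc b) = begin
      ⟦ suc a ⊖ suc b ⟧ℤ                     ≡⟨ cong ⟦_⟧ℤ (ℤ.[1+m]⊖[1+n]≡m⊖n a b) ⟩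
      ⟦ a ⊖ b ⟧ℤ                             ≡⟨ ⊖-homo a b ⟩
      a ×′ 1# - b ×′ 1#                      ≡⟨ 1+-cancel _ _ ⟨
      (1# + a ×′ 1#) - (1# + b ×′ 1#)        ≡⟨ cong₂ _-_ (×′-suc a) (×′-suc b) ⟨
      suc a ×′ 1# - suc b ×′ 1#              ∎
      where open ≡-Reasoning

    +-homo : ∀ i j → ⟦ i ℤ.+ j ⟧ℤ ≡ ⟦ i ⟧ℤ + ⟦ j ⟧ℤ
    +-homo (ℤ.+ a)    (ℤ.+ b)    = ×-homo-+ 1# a b
    +-homo (ℤ.+ a)    -[1+ b ] = ⊖-homo a (suc b)
    +-homo -[1+ a ] (ℤ.+ b)    = trans (⊖-homo b (suc a)) (+-comm _ _)
    +-homo -[1+ a ] -[1+ b ] = begin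
      - (suc (suc (a ℕ.+ b)) ×′ 1#)              ≡⟨ cong (λ k → - (k ×′ 1#)) (cong suc (ℕ.+-suc a b)) ⟨
      - ((suc a ℕ.+ suc b) ×′ 1#)                ≡⟨ cong -_ (×-homo-+ 1# (suc a) (suc b)) ⟩
      - (suc a ×′ 1# + suc b ×′ 1#)              ≡⟨ -‿anti-homo-+ _ _ ⟩
      - (suc b ×′ 1#) + - (suc a ×′ 1#)          ≡⟨ +-comm _ _ ⟩
      - (suc a ×′ 1#) + - (suc b ×′ 1#)          ∎
      where open ≡-Reasoning

    -homo : ∀ i → ⟦ ℤ.- i ⟧ℤ ≡ - ⟦ i ⟧ℤ
    -homo (ℤ.+ zero)   = sym -0#≈0#
    -homo (ℤ.+ suc k)  = refl
    -homo -[1+ k ]   = sym (-‿involutive _)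

    signed : Sign → F → F
    signed Sign.+ x = x
    signed Sign.- x = - x

    ◃-homo : ∀ s k → ⟦ s ◃ k ⟧ℤ ≡ signed s (k ×′ 1#)
    ◃-homo Sign.+ zero    = refl
    ◃-homo Sign.- zero    = sym -0#≈0#
    ◃-homo Sign.+ (suc k) = refl
    ◃-homo Sign.- (suc k) = refl

    sign-abs : ∀ i → ⟦ i ⟧ℤ ≡ signed (sign i) (∣ i ∣ ×′ 1#)
    sign-abs (ℤ.+ k)    = refl
    sign-abs -[1+ k ] = refl

    signed-* : ∀ s t x y → signed (s Sign.* t) (x * y) ≡ signed s x * signed t y
    signed-* Sign.+ Sign.+ x y = refl
    signed-* Sign.+ Sign.- x y = -‿distribʳ-* x y
    signed-* Sign.- Sign.+ x y = -‿distribˡ-* x y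
    signed-* Sign.- Sign.- x y = begin
      x * y           ≡⟨ -‿involutive _ ⟨
      - - (x * y)     ≡⟨ cong -_ (-‿distribʳ-* x y) ⟩
      - (x * - y)     ≡⟨ -‿distribˡ-* x (- y) ⟩
      - x * - y       ∎
      where open ≡-Reasoning

    *-homo : ∀ i j → ⟦ i ℤ.* j ⟧ℤ ≡ ⟦ i ⟧ℤ * ⟦ j ⟧ℤ
    *-homo i j = begin
      ⟦ i ℤ.* j ⟧ℤ                                                 ≡⟨ ◃-homo s (∣ i ∣ ℕ.* ∣ j ∣) ⟩
      signed s ((∣ i ∣ ℕ.* ∣ j ∣) ×′ 1#)                            ≡⟨ cong (signed s) (×1-homo-* ∣ i ∣ ∣ j ∣) ⟩
      signed s ((∣ i ∣ ×′ 1#) * (∣ j ∣ ×′ 1#))                       ≡⟨ signed-* (sign i) (sign j) _ _ ⟩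
      signed (sign i) (∣ i ∣ ×′ 1#) * signed (sign j) (∣ j ∣ ×′ 1#) ≡⟨ cong₂ _*_ (sign-abs i) (sign-abs j) ⟨
      ⟦ i ⟧ℤ * ⟦ j ⟧ℤ                                               ∎
      where
      open ≡-Reasoning
      s : Sign
      s = sign i Sign.* sign j

    almostCommutativeRing : AlmostCommutativeRing 0ℓ 0ℓ
    almostCommutativeRing = fromCommutativeRing commutativeRing

    ℤ-morphism : ℤ.+-*-rawRing -Raw-AlmostCommutative⟶ almostCommutativeRing
    ℤ-morphism = record
      { ⟦_⟧ = ⟦_⟧ℤ ; +-homo = +-homo ; *-homo = *-homo ; -‿homo = -homo ; 0-homo = refl ; 1-homo = refl }

    ℤ-coefficients-equal? : ∀ i j → Maybe (⟦ i ⟧ℤ ≡ ⟦ j ⟧ℤ)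
    ℤ-coefficients-equal? i j with i ℤ.≟ j
    ... | yes i≡j = just (cong ⟦_⟧ℤ i≡j)
    ... | no _    = nothing

  open Solver ℤ.+-*-rawRing almostCommutativeRing ℤ-morphism ℤ-coefficients-equal? public
    using (solve; _:=_; _:+_; _:*_; _:-_; :-_; con)

module FieldProperties {n : ℕ} (K : FiniteField n) where

  open import Level using (0ℓ)
  open import Data.Nat using (zero; suc)
  open import Data.Fin as Fin using (Fin)
  import Data.Fin.Properties as Fin
  open import Data.Fin.Permutation using (Permutation)
  open import Data.Vec.Functional using (removeAt)
  open import Data.Sum using (_⊎_; inj₁; inj₂; [_,_]′)
  open import Data.Empty using (⊥-elim)
  open import Relation.Nullary using (yes; no)
  open import Relation.Nullary.Decidable using (via-injection)
  open import Relation.Binary.Definitions using (DecidableEquality)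
  open import Relation.Binary.PropositionalEquality
  open import Function.Base using (id; _∘_)
  open import Function.Bundles using (Inverse; _↔_; mk↔ₛ′)
  open import Function.Properties.Inverse using (Inverse⇒Injection; ↔-sym; ↔-trans)
  open import Algebra.Bundles using (CommutativeMonoid)
  import Algebra.Properties.CommutativeMonoid.Sum
  open FiniteFieldSolver K public

  _≟_ : DecidableEquality F
  _≟_ = via-injection (Inverse⇒Injection enum) Fin._≟_

  ⁻¹-inverseˡ : ∀ {x} → x ≢ 0# → x ⁻¹ * x ≡ 1#
  ⁻¹-inverseˡ {x} x≢0 = trans (*-comm (x ⁻¹) x) (⁻¹-inverse x x≢0)

  *-cancelˡ : ∀ {x y z} → x ≢ 0# → x * y ≡ x * z → y ≡ z
  *-cancelˡ {x} {y} {z} x≢0 xy≡xz = begin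
    y                ≡⟨ *-identityˡ y ⟨
    1# * y           ≡⟨ cong (_* y) (⁻¹-inverseˡ x≢0) ⟨
    x ⁻¹ * x * y     ≡⟨ *-assoc _ x y ⟩
    x ⁻¹ * (x * y)   ≡⟨ cong (x ⁻¹ *_) xy≡xz ⟩
    x ⁻¹ * (x * z)   ≡⟨ *-assoc _ x z ⟨
    x ⁻¹ * x * z     ≡⟨ cong (_* z) (⁻¹-inverseˡ x≢0) ⟩
    1# * z           ≡⟨ *-identityˡ z ⟩
    z                ∎
    where open ≡-Reasoning

  *-cancelˡ-zero : ∀ {x y} → x ≢ 0# → x * y ≡ 0# → y ≡ 0#
  *-cancelˡ-zero {x} x≢0 xy≡0 = *-cancelˡ x≢0 (trans xy≡0 (sym (zeroʳ x)))

  zero-product : ∀ {x y} → x * y ≡ 0# → x ≡ 0# ⊎ y ≡ 0#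
  zero-product {x} xy≡0 with x ≟ 0#
  ... | yes x≡0 = inj₁ x≡0
  ... | no  x≢0 = inj₂ (*-cancelˡ-zero x≢0 xy≡0)

  *-≢0 : ∀ {x y} → x ≢ 0# → y ≢ 0# → x * y ≢ 0#
  *-≢0 x≢0 y≢0 xy≡0 = [ x≢0 , y≢0 ]′ (zero-product xy≡0)

  1≢0 : 1# ≢ 0#
  1≢0 1≡0 = 0≢1 (sym 1≡0)

  -‿≢0 : ∀ {x} → x ≢ 0# → - x ≢ 0#
  -‿≢0 {x} x≢0 -x≡0 = x≢0 (trans (sym (-‿involutive x)) (trans (cong -_ -x≡0) -0#≈0#))

  x-y≡0⇒x≡y : ∀ {x y} → x - y ≡ 0# → x ≡ y
  x-y≡0⇒x≡y = x∙y⁻¹≈ε⇒x≈y _ _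

  x≡y⇒x-y≡0 : ∀ {x y} → x ≡ y → x - y ≡ 0#
  x≡y⇒x-y≡0 = x≈y⇒x∙y⁻¹≈ε

  square-roots : ∀ {x y} → x * x ≡ y * y → x ≡ y ⊎ x ≡ - y
  square-roots {x} {y} x²≡y² with zero-product (trans difference-of-squares (x≡y⇒x-y≡0 x²≡y²))
    where
    difference-of-squares : (x - y) * (x + y) ≡ x * x - y * y
    difference-of-squares = solve 2 (λ x y → (x :- y) :* (x :+ y) := x :* x :- y :* y) refl x y
  ... | inj₁ x-y≡0 = inj₁ (x-y≡0⇒x≡y x-y≡0)
  ... | inj₂ x+y≡0 = inj₂ (x-y≡0⇒x≡y (trans (cong (x +_) (-‿involutive y)) x+y≡0))

  *-⁻¹-cancelʳ : ∀ x {y} → y ≢ 0# → x * y ⁻¹ * y ≡ x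
  *-⁻¹-cancelʳ x {y} y≢0 = begin
    x * y ⁻¹ * y      ≡⟨ *-assoc x _ y ⟩
    x * (y ⁻¹ * y)    ≡⟨ cong (x *_) (⁻¹-inverseˡ y≢0) ⟩
    x * 1#            ≡⟨ *-identityʳ x ⟩
    x                 ∎
    where open ≡-Reasoning

  cross-multiplied⇒quotient : ∀ {a b x y} → y ≢ 0# → a * y ≡ b * x → a ≡ b * (x * y ⁻¹)
  cross-multiplied⇒quotient {a} {b} {x} {y} y≢0 ay≡bx = begin
    a                  ≡⟨ *-identityʳ a ⟨
    a * 1#             ≡⟨ cong (a *_) (⁻¹-inverse y y≢0) ⟨
    a * (y * y ⁻¹)     ≡⟨ *-assoc a y _ ⟨
    a * y * y ⁻¹       ≡⟨ cong (_* y ⁻¹) ay≡bx ⟩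
    b * x * y ⁻¹       ≡⟨ *-assoc b x _ ⟩
    b * (x * y ⁻¹)     ∎
    where open ≡-Reasoning

  quotient⇒cross-multiplied : ∀ {a b x y} → y ≢ 0# → a ≡ b * (x * y ⁻¹) → a * y ≡ b * x
  quotient⇒cross-multiplied {a} {b} {x} {y} y≢0 a≡b[x/y] = begin
    a * y                 ≡⟨ cong (_* y) a≡b[x/y] ⟩
    b * (x * y ⁻¹) * y    ≡⟨ solve 4 (λ b x i y → b :* (x :* i) :* y := b :* x :* (y :* i))
                                     refl b x (y ⁻¹) y ⟩
    b * x * (y * y ⁻¹)    ≡⟨ cong (b * x *_) (⁻¹-inverse y y≢0) ⟩
    b * x * 1#            ≡⟨ *-identityʳ _ ⟩
    b * x                 ∎
    where open ≡-Reasoning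

  element : Fin n → F
  element = Inverse.from enum

  module _ (M : CommutativeMonoid 0ℓ 0ℓ) where
    open CommutativeMonoid M using (Carrier; _≈_) renaming (trans to ≈-trans; reflexive to ≈-reflexive)
    open import Algebra.Properties.CommutativeMonoid.Sum M using (sum; sum-permute; sum-cong-≗)

    fold-invariant : (σ : F ↔ F) (f : F → Carrier) →
      sum (λ i → f (element i)) ≈ sum (λ i → f (Inverse.to σ (element i)))
    fold-invariant σ f = ≈-trans (sum-permute (λ i → f (element i)) π)
      (≈-reflexive (sum-cong-≗ {n} (λ i → cong f (Inverse.strictlyInverseʳ enum (Inverse.to σ (element i))))))
      where
      π : Permutation n n
      π = ↔-trans (↔-sym enum) (↔-trans σ enum)

  open import Algebra.Properties.Semiring.Mult semiring public using (_×_)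
  open import Algebra.Properties.Semiring.Exp semiring public
    using (^-assocʳ) renaming (_^_ to _^ᴿ_)
  module ∑ = Algebra.Properties.CommutativeMonoid.Sum +-commutativeMonoid
  module ∏ = Algebra.Properties.CommutativeMonoid.Sum *-commutativeMonoid

  pow≡^ : ∀ x k → pow x k ≡ x ^ᴿ k
  pow≡^ x zero    = refl
  pow≡^ x (suc k) = cong (x *_) (pow≡^ x k)

  translation : F → F ↔ F
  translation a = mk↔ₛ′ (_+ a) (_- a)
    (λ x → solve 2 (λ x a → (x :- a) :+ a := x) refl x a)
    (λ x → solve 2 (λ x a → (x :+ a) :- a := x) refl x a)

  n×x≡0 : ∀ x → n × x ≡ 0#
  n×x≡0 a = +-cancelˡ S (n × a) 0# (begin
    S + n × a                        ≡⟨ cong (S +_) (∑.sum-replicate n {a}) ⟨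
    S + ∑.sum {n} (λ _ → a)          ≡⟨ ∑.∑-distrib-+ element (λ _ → a) ⟨
    ∑.sum {n} (λ i → element i + a)  ≡⟨ fold-invariant +-commutativeMonoid (translation a) id ⟨
    S                                ≡⟨ +-identityʳ S ⟨
    S + 0#                           ∎)
    where
    open ≡-Reasoning
    S : F
    S = ∑.sum {n} element

  scaling : ∀ a → a ≢ 0# → F ↔ F
  scaling a a≢0 = mk↔ₛ′ (a *_) (a ⁻¹ *_)
    (λ x → trans (sym (*-assoc a _ x)) (trans (cong (_* x) (⁻¹-inverse a a≢0)) (*-identityˡ x)))
    (λ x → trans (sym (*-assoc _ a x)) (trans (cong (_* x) (⁻¹-inverseˡ a≢0)) (*-identityˡ x)))

  if-zero : F → F → F → F
  if-zero x u v with x ≟ 0#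
  ... | yes _ = u
  ... | no  _ = v

  if-zero-yes : ∀ {x} u v → x ≡ 0# → if-zero x u v ≡ u
  if-zero-yes {x} u v x≡0 with x ≟ 0#
  ... | yes _   = refl
  ... | no  x≢0 = ⊥-elim (x≢0 x≡0)

  if-zero-no : ∀ {x} u v → x ≢ 0# → if-zero x u v ≡ v
  if-zero-no {x} u v x≢0 with x ≟ 0#
  ... | yes x≡0 = ⊥-elim (x≢0 x≡0)
  ... | no  _   = refl

  ∏-≢0 : ∀ {k} (f : Fin k → F) → (∀ i → f i ≢ 0#) → ∏.sum f ≢ 0#
  ∏-≢0 {zero}  f f≢0 = 1≢0
  ∏-≢0 {suc k} f f≢0 = *-≢0 (f≢0 Fin.zero) (∏-≢0 (λ i → f (Fin.suc i)) (λ i → f≢0 (Fin.suc i)))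

  ∏-single-factor : ∀ {k} (f : Fin k → F) i → (∀ j → j ≢ i → f j ≡ 1#) → ∏.sum f ≡ f i
  ∏-single-factor {suc k} f i others≡1 = begin
    ∏.sum f                                ≡⟨ ∏.sum-remove {i = i} f ⟩
    f i * ∏.sum (removeAt f i)             ≡⟨ cong (f i *_) (∏.sum-cong-≗ {k} λ j →
                                                others≡1 _ (Fin.punchInᵢ≢i i j)) ⟩
    f i * ∏.sum {k} (λ _ → 1#)             ≡⟨ cong (f i *_) (∏.sum-replicate-zero k) ⟩
    f i * 1#                               ≡⟨ *-identityʳ (f i) ⟩
    f i                                    ∎
    where open ≡-Reasoning

  -- ι is the identity with 0# replaced by 1#; reindexing ∏ ι along x ↦ a x shows that
  -- the factors a at the nonzero x multiply to 1#, i.e. a ^ (n − 1) = 1#.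
  fermat-≢0 : ∀ {a} → a ≢ 0# → pow a n ≡ a
  fermat-≢0 {a} a≢0 = begin
    pow a n                              ≡⟨ pow≡^ a n ⟩
    a ^ᴿ n                               ≡⟨ ∏.sum-replicate n ⟨
    ∏.sum {n} (λ _ → a)                  ≡⟨ ∏.sum-cong-≗ {n} (λ i → α*β≡a (element i)) ⟨
    ∏.sum (λ i → α (element i) * β (element i))
                                         ≡⟨ ∏.∑-distrib-+ (α ∘ element) (β ∘ element) ⟩
    ∏.sum (α ∘ element) * ∏.sum (β ∘ element)
                                         ≡⟨ cong₂ _*_ ∏α≡1 ∏β≡a ⟩
    1# * a                               ≡⟨ *-identityˡ a ⟩
    a                                    ∎
    where
    open ≡-Reasoning
    ι α β : F → F
    ι x = if-zero x 1# x
    α x = if-zero x 1# a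
    β x = if-zero x a 1#

    α*β≡a : ∀ x → α x * β x ≡ a
    α*β≡a x with x ≟ 0#
    ... | yes _ = *-identityˡ a
    ... | no  _ = *-identityʳ a

    ι≢0 : ∀ x → ι x ≢ 0#
    ι≢0 x with x ≟ 0#
    ... | yes _   = 1≢0
    ... | no  x≢0 = x≢0

    ι-scaled : ∀ x → ι (a * x) ≡ α x * ι x
    ι-scaled x with x ≟ 0#
    ... | yes x≡0 = begin
      ι (a * x)    ≡⟨ if-zero-yes 1# _ (trans (cong (a *_) x≡0) (zeroʳ a)) ⟩
      1#           ≡⟨ *-identityˡ 1# ⟨
      1# * 1#      ∎
    ... | no  x≢0 = if-zero-no 1# _ (*-≢0 a≢0 x≢0)

    P : F
    P = ∏.sum (ι ∘ element)

    ∏α≡1 : ∏.sum (α ∘ element) ≡ 1#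
    ∏α≡1 = *-cancelˡ (∏-≢0 (ι ∘ element) (ι≢0 ∘ element)) (begin
      P * ∏.sum (α ∘ element)                 ≡⟨ *-comm P _ ⟩
      ∏.sum (α ∘ element) * P                 ≡⟨ ∏.∑-distrib-+ (α ∘ element) (ι ∘ element) ⟨
      ∏.sum (λ i → α (element i) * ι (element i))
                                              ≡⟨ ∏.sum-cong-≗ {n} (ι-scaled ∘ element) ⟨
      ∏.sum (λ i → ι (a * element i))         ≡⟨ fold-invariant *-commutativeMonoid (scaling a a≢0) ι ⟨
      P                                       ≡⟨ *-identityʳ P ⟨
      P * 1#                                  ∎)

    zero-index : Fin n
    zero-index = Inverse.to enum 0#

    ∏β≡a : ∏.sum (β ∘ element) ≡ a
    ∏β≡a = begin
      ∏.sum (β ∘ element)           ≡⟨ ∏-single-factor (β ∘ element) zero-index β≡1-elsewhere ⟩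
      β (element zero-index)        ≡⟨ if-zero-yes a 1# (Inverse.strictlyInverseʳ enum 0#) ⟩
      a                             ∎
      where
      β≡1-elsewhere : ∀ j → j ≢ zero-index → β (element j) ≡ 1#
      β≡1-elsewhere j j≢i = if-zero-no a 1#
        (λ e≡0 → j≢i (trans (sym (Inverse.strictlyInverseˡ enum j)) (cong (Inverse.to enum) e≡0)))

  fermat : ∀ x → pow x n ≡ x
  fermat x with x ≟ 0#
  ... | no  x≢0 = fermat-≢0 x≢0
  ... | yes refl = pow-zero n (Inverse.to enum 0#)
    where
    pow-zero : ∀ k → Fin k → pow 0# k ≡ 0#
    pow-zero (suc k) _ = zeroˡ (pow 0# k)

module Conjugation (p m : ℕ) (p-prime : Prime p) (K : FiniteField ((p ^ m) ^ 2)) where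

  open import Data.Nat as ℕ using (zero; suc)
  import Data.Nat.Properties as ℕ
  open import Data.Nat.DivMod using (_/_)
  open import Data.Sum using ([_,_]′)
  open import Data.Empty using (⊥-elim)
  open import Function.Base using (id)
  open import Relation.Binary.PropositionalEquality
  open PrimeDivisibility using (odd-prime)
  open FieldProperties K public
  open Plane (p ^ m) K public using (bar)
  open import Algebra.Properties.Semiring.Mult semiring using (×1-homo-*; ×-homo-+)
  open import Algebra.Properties.CommutativeSemiring.Exp commutativeSemiring using (^-distrib-*)

  q : ℕ
  q = p ^ m

  ×1-homo-^ : ∀ a k → (a ^ k) × 1# ≡ (a × 1#) ^ᴿ k
  ×1-homo-^ a zero    = +-identityʳ 1#
  ×1-homo-^ a (suc k) = trans (×1-homo-* a (a ^ k)) (cong ((a × 1#) *_) (×1-homo-^ a k))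

  ^ᴿ≡0⇒≡0 : ∀ {x} k → x ^ᴿ k ≡ 0# → x ≡ 0#
  ^ᴿ≡0⇒≡0 zero    1≡0 = ⊥-elim (1≢0 1≡0)
  ^ᴿ≡0⇒≡0 (suc k) x^k≡0 = [ id , ^ᴿ≡0⇒≡0 k ]′ (zero-product x^k≡0)

  char-p : p × 1# ≡ 0#
  char-p = ^ᴿ≡0⇒≡0 m (^ᴿ≡0⇒≡0 2 (begin
    ((p × 1#) ^ᴿ m) ^ᴿ 2   ≡⟨ cong (_^ᴿ 2) (×1-homo-^ p m) ⟨
    (q × 1#) ^ᴿ 2         ≡⟨ ×1-homo-^ q 2 ⟨
    (q ^ 2) × 1#          ≡⟨ n×x≡0 1# ⟩
    0#                    ∎))
    where open ≡-Reasoning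

  bar-+ : ∀ x y → bar (x + y) ≡ bar x + bar y
  bar-+ x y = begin
    pow (x + y) q          ≡⟨ pow≡^ (x + y) q ⟩
    (x + y) ^ᴿ q           ≡⟨ Frobenius.frobenius-iterated commutativeSemiring p-prime char-p m x y ⟩
    x ^ᴿ q + y ^ᴿ q        ≡⟨ cong₂ _+_ (pow≡^ x q) (pow≡^ y q) ⟨
    pow x q + pow y q      ∎
    where open ≡-Reasoning

  bar-* : ∀ x y → bar (x * y) ≡ bar x * bar y
  bar-* x y = begin
    pow (x * y) q          ≡⟨ pow≡^ (x * y) q ⟩
    (x * y) ^ᴿ q           ≡⟨ ^-distrib-* x y q ⟩
    x ^ᴿ q * y ^ᴿ q        ≡⟨ cong₂ _*_ (pow≡^ x q) (pow≡^ y q) ⟨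
    pow x q * pow y q      ∎
    where open ≡-Reasoning

  bar-involutive : ∀ x → bar (bar x) ≡ x
  bar-involutive x = begin
    pow (pow x q) q        ≡⟨ trans (cong (λ y → pow y q) (pow≡^ x q)) (pow≡^ (x ^ᴿ q) q) ⟩
    (x ^ᴿ q) ^ᴿ q          ≡⟨ ^-assocʳ x q q ⟩
    x ^ᴿ (q ℕ.* q)         ≡⟨ cong (x ^ᴿ_) (cong (q ℕ.*_) (ℕ.*-identityʳ q)) ⟨
    x ^ᴿ (q ^ 2)           ≡⟨ pow≡^ x (q ^ 2) ⟨
    pow x (q ^ 2)          ≡⟨ fermat x ⟩
    x                      ∎
    where open ≡-Reasoning

  bar-0 : bar 0# ≡ 0#
  bar-0 = x+x≈x⇒x≈0 (bar 0#) (trans (sym (bar-+ 0# 0#)) (cong bar (+-identityʳ 0#)))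

  bar-1 : bar 1# ≡ 1#
  bar-1 = pow-1 q
    where
    pow-1 : ∀ k → pow 1# k ≡ 1#
    pow-1 zero    = refl
    pow-1 (suc k) = trans (*-identityˡ _) (pow-1 k)

  bar-2 : bar 2# ≡ 2#
  bar-2 = trans (bar-+ 1# 1#) (cong₂ _+_ bar-1 bar-1)

  bar-‿ : ∀ x → bar (- x) ≡ - bar x
  bar-‿ x = +-inverseˡ-unique (bar (- x)) (bar x)
    (trans (sym (bar-+ (- x) x)) (trans (cong bar (-‿inverseˡ x)) bar-0))

  bar-- : ∀ x y → bar (x - y) ≡ bar x - bar y
  bar-- x y = trans (bar-+ x (- y)) (cong (bar x +_) (bar-‿ y))

  bar-≢0 : ∀ {x} → x ≢ 0# → bar x ≢ 0#
  bar-≢0 {x} x≢0 bar≡0 = x≢0 (trans (sym (bar-involutive x)) (trans (cong bar bar≡0) bar-0))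

  bar-⁻¹ : ∀ {x} → x ≢ 0# → bar (x ⁻¹) ≡ bar x ⁻¹
  bar-⁻¹ {x} x≢0 = *-cancelˡ (bar-≢0 x≢0) (begin
    bar x * bar (x ⁻¹)     ≡⟨ bar-* x (x ⁻¹) ⟨
    bar (x * x ⁻¹)         ≡⟨ cong bar (⁻¹-inverse x x≢0) ⟩
    bar 1#                 ≡⟨ bar-1 ⟩
    1#                     ≡⟨ ⁻¹-inverse (bar x) (bar-≢0 x≢0) ⟨
    bar x * bar x ⁻¹       ∎)
    where open ≡-Reasoning

  2≢0 : ¬ (p ≡ 2) → 2# ≢ 0#
  2≢0 p≢2 2≡0 = 1≢0 (begin
    1#                             ≡⟨ +-identityʳ 1# ⟨
    1# + 0#                        ≡⟨ cong (1# +_) (trans (cong ((k × 1#) *_) 2×1≡0) (zeroʳ _)) ⟨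
    1# + (k × 1#) * (2 × 1#)       ≡⟨ cong (1# +_) (×1-homo-* k 2) ⟨
    1# + (k ℕ.* 2) × 1#            ≡⟨ cong (_+ (k ℕ.* 2) × 1#) (+-identityʳ 1#) ⟨
    1 × 1# + (k ℕ.* 2) × 1#        ≡⟨ ×-homo-+ 1# 1 (k ℕ.* 2) ⟨
    (1 ℕ.+ k ℕ.* 2) × 1#           ≡⟨ cong (_× 1#) (odd-prime p-prime p≢2) ⟨
    p × 1#                         ≡⟨ char-p ⟩
    0#                             ∎)
    where
    open ≡-Reasoning
    k : ℕ
    k = p / 2
    2×1≡0 : 2 × 1# ≡ 0#
    2×1≡0 = trans (cong (1# +_) (+-identityʳ 1#)) 2≡0

module Geometry (p m : ℕ) (p-prime : Prime p) (p≢2 : ¬ (p ≡ 2)) (K : FiniteField ((p ^ m) ^ 2)) where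

  import Data.Integer as ℤ
  open import Data.Maybe using (just; nothing)
  import Data.Maybe.Properties as Maybe
  open import Data.Product using (Σ; _×_; _,_; proj₁; proj₂)
  open import Data.Sum using (_⊎_; inj₁; inj₂; [_,_]′)
  open import Data.Empty using (⊥-elim)
  open import Function.Bundles using (_⇔_; mk⇔; Equivalence)
  open import Function.Construct.Identity using (⇔-id)
  open import Relation.Binary.PropositionalEquality
  open Conjugation p m p-prime K hiding (_×_)
  open Plane (p ^ m) K using (InGFq; B¹; B²; SameSet; Distinct; Tangent)

  zero-combination₂ : ∀ {h₁ h₂} a₁ a₂ → h₁ ≡ 0# → h₂ ≡ 0# → a₁ * h₁ + a₂ * h₂ ≡ 0#
  zero-combination₂ a₁ a₂ refl refl =
    solve 2 (λ a₁ a₂ → a₁ :* con (ℤ.+ 0) :+ a₂ :* con (ℤ.+ 0) := con (ℤ.+ 0)) refl a₁ a₂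

  zero-combination₃ : ∀ {h₁ h₂ h₃} a₁ a₂ a₃ → h₁ ≡ 0# → h₂ ≡ 0# → h₃ ≡ 0# →
    a₁ * h₁ + a₂ * h₂ + a₃ * h₃ ≡ 0#
  zero-combination₃ a₁ a₂ a₃ refl refl refl = solve 3 (λ a₁ a₂ a₃ →
    a₁ :* con (ℤ.+ 0) :+ a₂ :* con (ℤ.+ 0) :+ a₃ :* con (ℤ.+ 0) := con (ℤ.+ 0)) refl a₁ a₂ a₃

  zero-combination₄ : ∀ {h₁ h₂ h₃ h₄} a₁ a₂ a₃ a₄ → h₁ ≡ 0# → h₂ ≡ 0# → h₃ ≡ 0# → h₄ ≡ 0# →
    a₁ * h₁ + a₂ * h₂ + a₃ * h₃ + a₄ * h₄ ≡ 0#
  zero-combination₄ a₁ a₂ a₃ a₄ refl refl refl refl = solve 4 (λ a₁ a₂ a₃ a₄ →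
    a₁ :* con (ℤ.+ 0) :+ a₂ :* con (ℤ.+ 0) :+ a₃ :* con (ℤ.+ 0) :+ a₄ :* con (ℤ.+ 0) := con (ℤ.+ 0))
    refl a₁ a₂ a₃ a₄

  module _ {c r : F} (c-real : InGFq c) where

    on-real-circle : ∀ {z} → B¹ c r (just z) ⇔ (z - c) * (bar z - c) ≡ r
    on-real-circle {z} = mk⇔ (subst (λ c̄ → (z - c) * (bar z - c̄) ≡ r) c-real)
                             (subst (λ c̄ → (z - c) * (bar z - c̄) ≡ r) (sym c-real))

    on-real-circle-at-real-point : ∀ {z} → InGFq z → B¹ c r (just z) ⇔ (z - c) * (z - c) ≡ r
    on-real-circle-at-real-point {z} z-real = mk⇔
      (λ z∈C → subst (λ z̄ → (z - c) * (z̄ - c) ≡ r) z-real (Equivalence.to on-real-circle z∈C))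
      (λ sq → Equivalence.from on-real-circle (subst (λ z̄ → (z - c) * (z̄ - c) ≡ r) (sym z-real) sq))

    real-circle-bar-closed : ∀ {z} → B¹ c r (just z) → B¹ c r (just (bar z))
    real-circle-bar-closed {z} z∈C = Equivalence.from on-real-circle (begin
      (bar z - c) * (bar (bar z) - c)   ≡⟨ cong (λ w → (bar z - c) * (w - c)) (bar-involutive z) ⟩
      (bar z - c) * (z - c)             ≡⟨ *-comm _ _ ⟩
      (z - c) * (bar z - c)             ≡⟨ Equivalence.to on-real-circle z∈C ⟩
      r                                 ∎)
      where open ≡-Reasoning

  real-+ : ∀ {x y} → InGFq x → InGFq y → InGFq (x + y)
  real-+ {x} {y} x-real y-real = trans (bar-+ x y) (cong₂ _+_ x-real y-real)

  real-- : ∀ {x y} → InGFq x → InGFq y → InGFq (x - y)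
  real-- {x} {y} x-real y-real = trans (bar-- x y) (cong₂ _-_ x-real y-real)

  real-* : ∀ {x y} → InGFq x → InGFq y → InGFq (x * y)
  real-* {x} {y} x-real y-real = trans (bar-* x y) (cong₂ _*_ x-real y-real)

  real-⁻¹ : ∀ {x} → x ≢ 0# → InGFq x → InGFq (x ⁻¹)
  real-⁻¹ x≢0 x-real = trans (bar-⁻¹ x≢0) (cong _⁻¹ x-real)

  -- Two circles with real centres are symmetric under conjugation, so a real
  -- common point is a point of tangency.
  real-centres-meet-once : ∀ {c₁ r₁ c₂ r₂ z y} → InGFq c₁ → InGFq c₂ → c₁ ≢ c₂ → InGFq z →
    B¹ c₁ r₁ (just z) → B¹ c₂ r₂ (just z) → B¹ c₁ r₁ (just y) → B¹ c₂ r₂ (just y) → y ≡ z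
  real-centres-meet-once {c₁} {r₁} {c₂} {r₂} {z} {y} c₁-real c₂-real c₁≢c₂ z-real z∈C₁ z∈C₂ y∈C₁ y∈C₂ =
    [ x-y≡0⇒x≡y , (λ ȳ-z≡0 → trans (sym (bar-involutive y)) (trans (cong bar (x-y≡0⇒x≡y ȳ-z≡0)) z-real)) ]′
      (zero-product π≡0)
    where
    σ π : F
    σ = (y - z) + (bar y - z)
    π = (y - z) * (bar y - z)

    expansion : ∀ {c r} → InGFq c → B¹ c r (just y) → B¹ c r (just z) → (z - c) * σ + π ≡ 0#
    expansion {c} {r} c-real y∈C z∈C = begin
      (z - c) * σ + π                             ≡⟨ identity ⟨
      (y - c) * (bar y - c) - (z - c) * (z - c)   ≡⟨ cong₂ _-_ (Equivalence.to (on-real-circle c-real) y∈C)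
        (Equivalence.to (on-real-circle-at-real-point c-real z-real) z∈C) ⟩
      r - r                                       ≡⟨ -‿inverseʳ r ⟩
      0#                                          ∎
      where
      open ≡-Reasoning
      identity : (y - c) * (bar y - c) - (z - c) * (z - c) ≡ (z - c) * σ + π
      identity = solve 4 (λ y ȳ z c →
        (y :- c) :* (ȳ :- c) :- (z :- c) :* (z :- c) := (z :- c) :* ((y :- z) :+ (ȳ :- z)) :+ (y :- z) :* (ȳ :- z))
        refl y (bar y) z c

    σ≡0 : σ ≡ 0#
    σ≡0 = *-cancelˡ-zero (λ c₂-c₁≡0 → c₁≢c₂ (sym (x-y≡0⇒x≡y c₂-c₁≡0))) (begin
      (c₂ - c₁) * σ                               ≡⟨ identity ⟩
      ((z - c₁) * σ + π) - ((z - c₂) * σ + π)     ≡⟨ cong₂ _-_ (expansion c₁-real y∈C₁ z∈C₁)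
                                                                (expansion c₂-real y∈C₂ z∈C₂) ⟩
      0# - 0#                                     ≡⟨ -‿inverseʳ 0# ⟩
      0#                                          ∎)
      where
      open ≡-Reasoning
      identity : (c₂ - c₁) * σ ≡ ((z - c₁) * σ + π) - ((z - c₂) * σ + π)
      identity = solve 5 (λ z c₁ c₂ σ π → (c₂ :- c₁) :* σ := ((z :- c₁) :* σ :+ π) :- ((z :- c₂) :* σ :+ π))
        refl z c₁ c₂ σ π

    π≡0 : π ≡ 0#
    π≡0 = begin
      π                          ≡⟨ +-identityˡ π ⟨
      0# + π                     ≡⟨ cong (_+ π) (trans (cong ((z - c₁) *_) σ≡0) (zeroʳ _)) ⟨
      (z - c₁) * σ + π           ≡⟨ expansion c₁-real y∈C₁ z∈C₁ ⟩
      0#                         ∎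
      where open ≡-Reasoning

  module TangentLine (γ : F) (γ≢0 : γ ≢ 0#) (γ-γ̄≢0 : γ - bar γ ≢ 0#) where

    private
      G ω Ω n t : F
      G = bar γ
      ω = γ * (γ - G)
      Ω = G * (G - γ)
      n = ω * Ω
      t = ω + Ω

      bar-ω : bar ω ≡ Ω
      bar-ω = trans (bar-* γ (γ - G)) (cong (G *_) (trans (bar-- γ G) (cong (λ γ̄̄ → G - γ̄̄) (bar-involutive γ))))

      bar-Ω : bar Ω ≡ ω
      bar-Ω = trans (cong bar (sym bar-ω)) (bar-involutive ω)

      n-real : InGFq n
      n-real = trans (bar-* ω Ω) (trans (cong₂ _*_ bar-ω bar-Ω) (*-comm Ω ω))

      t-real : InGFq t
      t-real = trans (bar-+ ω Ω) (trans (cong₂ _+_ bar-ω bar-Ω) (+-comm Ω ω))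

      n≢0 : n ≢ 0#
      n≢0 = *-≢0 ω≢0 (λ Ω≡0 → ω≢0 (trans (sym bar-Ω) (trans (cong bar Ω≡0) bar-0)))
        where
        ω≢0 : ω ≢ 0#
        ω≢0 = *-≢0 γ≢0 γ-γ̄≢0

    module _ {c r z} (c-real : InGFq c) (z∈C : B¹ c r (just z)) (z∈L : B² γ 0# (just z)) where

      private
        Z μ : F
        Z = bar z
        μ = c * t * n ⁻¹

        μ-real : InGFq μ
        μ-real = real-* (real-* c-real t-real) (real-⁻¹ n≢0 n-real)

        μn-ct≡0 : μ * n - c * t ≡ 0#
        μn-ct≡0 = x≡y⇒x-y≡0 (*-⁻¹-cancelʳ (c * t) n≢0)

        circle : (z - c) * (Z - c) - r ≡ 0#
        circle = x≡y⇒x-y≡0 (Equivalence.to (on-real-circle c-real) z∈C)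

      -- μ ω − z is the second intersection of the line with the circle: the line is
      -- {s ω : s ∈ GF(q)}, and μ is the sum of the two roots of the resulting quadratic in s.
      mirror : F
      mirror = μ * ω - z

      bar-mirror : bar mirror ≡ μ * Ω - Z
      bar-mirror = trans (bar-- (μ * ω) z) (cong (_- Z) (trans (bar-* μ ω) (cong₂ _*_ μ-real bar-ω)))

      mirror∈L : B² γ 0# (just mirror)
      mirror∈L = begin
        G * mirror + γ * bar mirror                 ≡⟨ cong (λ w → G * mirror + γ * w) bar-mirror ⟩
        G * (μ * ω - z) + γ * (μ * Ω - Z)           ≡⟨ line-identity ⟩
        - (G * z + γ * Z)                           ≡⟨ cong -_ z∈L ⟩
        - 0#                                        ≡⟨ -0#≈0# ⟩
        0#                                          ∎
        where
        open ≡-Reasoning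
        line-identity : G * (μ * ω - z) + γ * (μ * Ω - Z) ≡ - (G * z + γ * Z)
        line-identity = solve 5 (λ γ G z Z μ →
          let ω = γ :* (γ :- G) ; Ω = G :* (G :- γ) in
          G :* (μ :* ω :- z) :+ γ :* (μ :* Ω :- Z) := :- (G :* z :+ γ :* Z))
          refl γ G z Z μ

      mirror∈C : B¹ c r (just mirror)
      mirror∈C = Equivalence.from (on-real-circle c-real) (begin
        (mirror - c) * (bar mirror - c)             ≡⟨ cong (λ w → (mirror - c) * (w - c)) bar-mirror ⟩
        (μ * ω - z - c) * (μ * Ω - Z - c)           ≡⟨ x-y≡0⇒x≡y (*-cancelˡ-zero n≢0 (trans certificate
                                                         (zero-combination₂ _ _ μn-ct≡0 z∈L))) ⟩
        (z - c) * (Z - c)                           ≡⟨ x-y≡0⇒x≡y circle ⟩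
        r                                           ∎)
        where
        open ≡-Reasoning
        certificate : n * ((μ * ω - z - c) * (μ * Ω - Z - c) - (z - c) * (Z - c))
          ≡ (μ * n - (ω * Z + Ω * z)) * (μ * n - c * t) + c * (ω - Ω) * (G - γ) * (G * z + γ * Z)
        certificate = solve 6 (λ γ G z Z c μ →
          let ω = γ :* (γ :- G) ; Ω = G :* (G :- γ) ; n = ω :* Ω ; t = ω :+ Ω in
          n :* ((μ :* ω :- z :- c) :* (μ :* Ω :- Z :- c) :- (z :- c) :* (Z :- c))
          := (μ :* n :- (ω :* Z :+ Ω :* z)) :* (μ :* n :- c :* t) :+ c :* (ω :- Ω) :* (G :- γ) :* (G :* z :+ γ :* Z))
          refl γ G z Z c μ

      mirror≡z⇒radius : mirror ≡ z → (2# * 2#) * (γ * bar γ) * r ≡ c * c * ((γ + bar γ) * (γ + bar γ))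
      mirror≡z⇒radius mirror≡z = x-y≡0⇒x≡y (*-cancelˡ-zero (-‿≢0 (*-≢0 γ-γ̄≢0 γ-γ̄≢0))
        (trans certificate (zero-combination₄ _ _ _ _ μn-ct≡0 e₂ e₁ circle)))
        where
        e₁ : μ * ω - z - z ≡ 0#
        e₁ = x≡y⇒x-y≡0 mirror≡z
        e₂ : μ * Ω - Z - Z ≡ 0#
        e₂ = x≡y⇒x-y≡0 (trans (sym bar-mirror) (cong bar mirror≡z))
        certificate : - ((γ - G) * (γ - G)) * ((2# * 2#) * (γ * G) * r - c * c * ((γ + G) * (γ + G)))
          ≡ (μ * n - c * t) * (μ * n - c * t) + (- (n * (μ * ω - 2# * c))) * (μ * Ω - Z - Z)
            + (- (n * ((μ * Ω - 2# * c) - (μ * Ω - Z - Z)))) * (μ * ω - z - z)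
            + (- ((2# * 2#) * n)) * ((z - c) * (Z - c) - r)
        certificate = solve 7 (λ γ G z Z c r μ →
          let ω = γ :* (γ :- G) ; Ω = G :* (G :- γ) ; n = ω :* Ω ; t = ω :+ Ω ; 2# = con (ℤ.+ 2) in
          (:- ((γ :- G) :* (γ :- G))) :* ((2# :* 2#) :* (γ :* G) :* r :- c :* c :* ((γ :+ G) :* (γ :+ G)))
          := (μ :* n :- c :* t) :* (μ :* n :- c :* t) :+ (:- (n :* (μ :* ω :- 2# :* c))) :* (μ :* Ω :- Z :- Z)
             :+ (:- (n :* ((μ :* Ω :- 2# :* c) :- (μ :* Ω :- Z :- Z)))) :* (μ :* ω :- z :- z)
             :+ (:- ((2# :* 2#) :* n)) :* ((z :- c) :* (Z :- c) :- r))
          refl γ G z Z c r μ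

    tangent⇒radius : ∀ {c r} → InGFq c → Tangent (B¹ c r) (B² γ 0#) →
      (2# * 2#) * (γ * bar γ) * r ≡ c * c * ((γ + bar γ) * (γ + bar γ))
    tangent⇒radius c-real (_ , nothing , (() , _) , _)
    tangent⇒radius c-real (_ , just z , (z∈C , z∈L) , unique) = mirror≡z⇒radius c-real z∈C z∈L
      (Maybe.just-injective (unique _ (mirror∈C c-real z∈C z∈L) (mirror∈L c-real z∈C z∈L)))

  module Tangency (γ : F) (γ²≢γ̄² : ¬ (pow γ 2 ≡ pow (bar γ) 2)) where

    N T : F
    N = γ * bar γ
    T = γ + bar γ

    γ-γ̄≢0 : γ - bar γ ≢ 0#
    γ-γ̄≢0 γ-γ̄≡0 = γ²≢γ̄² (x-y≡0⇒x≡y (begin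
      γ * (γ * 1#) - bar γ * (bar γ * 1#)    ≡⟨ difference-of-squares ⟨
      (γ - bar γ) * T                        ≡⟨ cong (_* T) γ-γ̄≡0 ⟩
      0# * T                                 ≡⟨ zeroˡ T ⟩
      0#                                     ∎))
      where
      open ≡-Reasoning
      difference-of-squares : (γ - bar γ) * T ≡ γ * (γ * 1#) - bar γ * (bar γ * 1#)
      difference-of-squares = solve 2 (λ γ G →
        (γ :- G) :* (γ :+ G) := γ :* (γ :* con (ℤ.+ 1)) :- G :* (G :* con (ℤ.+ 1))) refl γ (bar γ)

    γ≢0 : γ ≢ 0#
    γ≢0 γ≡0 = γ-γ̄≢0 (trans (cong₂ _-_ γ≡0 (trans (cong bar γ≡0) bar-0)) (-‿inverseʳ 0#))

    N≢0 : N ≢ 0#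
    N≢0 = *-≢0 γ≢0 (bar-≢0 γ≢0)

    4N≢0 : (2# * 2#) * N ≢ 0#
    4N≢0 = *-≢0 (*-≢0 (2≢0 p≢2) (2≢0 p≢2)) N≢0

    open TangentLine γ γ≢0 γ-γ̄≢0 public using (tangent⇒radius)

    2s±T≢0 : ∀ {s} → s * s ≡ N → (2# * s - T ≢ 0#) × (2# * s + T ≢ 0#)
    2s±T≢0 {s} s²≡N = (λ 2s-T≡0 → [2s-T][2s+T]≢0 (trans (cong (_* (2# * s + T)) 2s-T≡0) (zeroˡ _)))
                    , (λ 2s+T≡0 → [2s-T][2s+T]≢0 (trans (cong ((2# * s - T) *_) 2s+T≡0) (zeroʳ _)))
      where
      [2s-T][2s+T]≢0 : (2# * s - T) * (2# * s + T) ≢ 0#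
      [2s-T][2s+T]≢0 product≡0 = -‿≢0 (*-≢0 γ-γ̄≢0 γ-γ̄≢0)
        (trans certificate (zero-combination₂ _ _ product≡0 (x≡y⇒x-y≡0 s²≡N)))
        where
        certificate : - ((γ - bar γ) * (γ - bar γ))
          ≡ 1# * ((2# * s - T) * (2# * s + T)) + (- (2# * 2#)) * (s * s - N)
        certificate = solve 3 (λ γ G s → let 2# = con (ℤ.+ 2) ; T = γ :+ G in
          :- ((γ :- G) :* (γ :- G))
          := con (ℤ.+ 1) :* ((2# :* s :- T) :* (2# :* s :+ T)) :+ (:- (2# :* 2#)) :* (s :* s :- γ :* G))
          refl γ (bar γ) s

    T-real : InGFq T
    T-real = trans (bar-+ γ (bar γ)) (trans (cong (bar γ +_) (bar-involutive γ)) (+-comm (bar γ) γ))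

    real-point⇒square-root : ∀ {c r z} → r ≢ 0# → (2# * 2#) * N * r ≡ c * c * (T * T) →
      InGFq c → InGFq z → (z - c) * (z - c) ≡ r →
      Σ F (λ s → InGFq s × s * s ≡ N × s * (2# * (z - c)) ≡ c * T)
    real-point⇒square-root {c} {r} {z} r≢0 radius c-real z-real a²≡r = s , s-real , s²≡N , s·2a≡cT
      where
      a s : F
      a = z - c
      s = c * T * (2# * a) ⁻¹

      2a≢0 : 2# * a ≢ 0#
      2a≢0 = *-≢0 (2≢0 p≢2) (λ a≡0 → r≢0 (trans (sym a²≡r) (trans (cong (_* a) a≡0) (zeroˡ a))))

      s·2a≡cT : s * (2# * a) ≡ c * T
      s·2a≡cT = *-⁻¹-cancelʳ (c * T) 2a≢0

      s-real : InGFq s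
      s-real = real-* (real-* c-real T-real) (real-⁻¹ 2a≢0 (real-* bar-2 (real-- z-real c-real)))

      s²≡N : s * s ≡ N
      s²≡N = x-y≡0⇒x≡y (*-cancelˡ-zero (*-≢0 2a≢0 2a≢0) (trans certificate
        (zero-combination₃ _ _ _ (x≡y⇒x-y≡0 s·2a≡cT) (x≡y⇒x-y≡0 radius) (x≡y⇒x-y≡0 a²≡r))))
        where
        certificate : (2# * a) * (2# * a) * (s * s - N)
          ≡ (s * (2# * a) + c * T) * (s * (2# * a) - c * T) + (- 1#) * ((2# * 2#) * N * r - c * c * (T * T))
            + (- ((2# * 2#) * N)) * (a * a - r)
        certificate = solve 6 (λ a s N T c r → let 2# = con (ℤ.+ 2) in
          (2# :* a) :* (2# :* a) :* (s :* s :- N)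
          := (s :* (2# :* a) :+ c :* T) :* (s :* (2# :* a) :- c :* T)
             :+ (:- con (ℤ.+ 1)) :* ((2# :* 2#) :* N :* r :- c :* c :* (T :* T))
             :+ (:- ((2# :* 2#) :* N)) :* (a :* a :- r))
          refl a s N T c r

    root-relation⇔on-circle : ∀ {s c r} a → s * s ≡ N → (2# * 2#) * N * r ≡ c * c * (T * T) →
      (s * (2# * a)) * (s * (2# * a)) ≡ (c * T) * (c * T) ⇔ a * a ≡ r
    root-relation⇔on-circle {s} {c} {r} a s²≡N radius = mk⇔
      (λ squares≡ → x-y≡0⇒x≡y (*-cancelˡ-zero 4N≢0 (trans scaled (x≡y⇒x-y≡0 squares≡))))
      (λ a²≡r → x-y≡0⇒x≡y (trans (sym scaled)
        (trans (cong ((2# * 2#) * N *_) (x≡y⇒x-y≡0 a²≡r)) (zeroʳ _))))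
      where
      scaled : (2# * 2#) * N * (a * a - r) ≡ (s * (2# * a)) * (s * (2# * a)) - (c * T) * (c * T)
      scaled = x-y≡0⇒x≡y (trans certificate (zero-combination₂ _ _ (x≡y⇒x-y≡0 s²≡N) (x≡y⇒x-y≡0 radius)))
        where
        certificate : (2# * 2#) * N * (a * a - r) - ((s * (2# * a)) * (s * (2# * a)) - (c * T) * (c * T))
          ≡ (- ((2# * 2#) * (a * a))) * (s * s - N) + (- 1#) * ((2# * 2#) * N * r - c * c * (T * T))
        certificate = solve 6 (λ a s N T c r → let 2# = con (ℤ.+ 2) in
          (2# :* 2#) :* N :* (a :* a :- r) :- ((s :* (2# :* a)) :* (s :* (2# :* a)) :- (c :* T) :* (c :* T))
          := (:- ((2# :* 2#) :* (a :* a))) :* (s :* s :- N)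
             :+ (:- con (ℤ.+ 1)) :* ((2# :* 2#) :* N :* r :- c :* c :* (T :* T)))
          refl a s N T c r

    root-sign : ∀ {s z c₁ c₂} → c₁ ≢ c₂ → 2# * s + T ≢ 0# →
      s * (2# * (z - c₁)) ≡ c₁ * T → s * (2# * (z - c₂)) ≡ c₂ * T ⊎ s * (2# * (z - c₂)) ≡ - (c₂ * T) →
      c₂ * (2# * s - T) ≡ c₁ * (2# * s + T)
    root-sign {s} {z} {c₁} {c₂} c₁≢c₂ 2s+T≢0 root₁ (inj₁ root₂) = ⊥-elim
      ([ 2s+T≢0 , (λ c₁-c₂≡0 → c₁≢c₂ (x-y≡0⇒x≡y c₁-c₂≡0)) ]′ (zero-product (trans certificate
        (zero-combination₂ _ _ (x≡y⇒x-y≡0 root₂) (x≡y⇒x-y≡0 root₁)))))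
      where
      certificate : (2# * s + T) * (c₁ - c₂)
        ≡ 1# * (s * (2# * (z - c₂)) - c₂ * T) + (- 1#) * (s * (2# * (z - c₁)) - c₁ * T)
      certificate = solve 5 (λ z s T c₁ c₂ → let 2# = con (ℤ.+ 2) in
        (2# :* s :+ T) :* (c₁ :- c₂)
        := con (ℤ.+ 1) :* (s :* (2# :* (z :- c₂)) :- c₂ :* T)
           :+ (:- con (ℤ.+ 1)) :* (s :* (2# :* (z :- c₁)) :- c₁ :* T))
        refl z s T c₁ c₂
    root-sign {s} {z} {c₁} {c₂} _ _ root₁ (inj₂ root₂) = x-y≡0⇒x≡y (trans certificate
      (zero-combination₂ _ _ (x≡y⇒x-y≡0 root₁) (x≡y⇒x-y≡0 root₂)))
      where
      certificate : c₂ * (2# * s - T) - c₁ * (2# * s + T)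
        ≡ 1# * (s * (2# * (z - c₁)) - c₁ * T) + (- 1#) * (s * (2# * (z - c₂)) - - (c₂ * T))
      certificate = solve 5 (λ z s T c₁ c₂ → let 2# = con (ℤ.+ 2) in
        c₂ :* (2# :* s :- T) :- c₁ :* (2# :* s :+ T)
        := con (ℤ.+ 1) :* (s :* (2# :* (z :- c₁)) :- c₁ :* T)
           :+ (:- con (ℤ.+ 1)) :* (s :* (2# :* (z :- c₂)) :- :- (c₂ :* T)))
        refl z s T c₁ c₂

    CentresRelated : F → F → Set
    CentresRelated c₁ c₂ = Σ F (λ s → InGFq s × s * s ≡ N × c₂ * (2# * s - T) ≡ c₁ * (2# * s + T))

    centres-distinct : ∀ {c₁ r₁ c₂ r₂} → (2# * 2#) * N * r₁ ≡ c₁ * c₁ * (T * T) →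
      (2# * 2#) * N * r₂ ≡ c₂ * c₂ * (T * T) → Distinct (B¹ c₁ r₁) (B¹ c₂ r₂) → c₁ ≢ c₂
    centres-distinct radius₁ radius₂ distinct c₁≡c₂ = distinct (same-circle c₁≡c₂
      (*-cancelˡ 4N≢0 (trans radius₁ (trans (cong (λ c → c * c * (T * T)) c₁≡c₂) (sym radius₂)))))
      where
      same-circle : ∀ {c₁ r₁ c₂ r₂} → c₁ ≡ c₂ → r₁ ≡ r₂ → SameSet (B¹ c₁ r₁) (B¹ c₂ r₂)
      same-circle refl refl _ = ⇔-id _

    module TwoCircles {c₁ r₁ c₂ r₂} (c₁-real : InGFq c₁) (c₂-real : InGFq c₂) (c₁≢c₂ : c₁ ≢ c₂)
             (radius₁ : (2# * 2#) * N * r₁ ≡ c₁ * c₁ * (T * T))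
             (radius₂ : (2# * 2#) * N * r₂ ≡ c₂ * c₂ * (T * T)) where

      real-common-point⇒centres-related : ∀ {z} → r₁ ≢ 0# → InGFq z →
        (z - c₁) * (z - c₁) ≡ r₁ → (z - c₂) * (z - c₂) ≡ r₂ → CentresRelated c₁ c₂
      real-common-point⇒centres-related {z} r₁≢0 z-real on-C₁ on-C₂ =
        extend (real-point⇒square-root r₁≢0 radius₁ c₁-real z-real on-C₁)
        where
        extend : Σ F (λ s → InGFq s × s * s ≡ N × s * (2# * (z - c₁)) ≡ c₁ * T) → CentresRelated c₁ c₂
        extend (s , s-real , s²≡N , root₁) =
          s , s-real , s²≡N , root-sign c₁≢c₂ (proj₂ (2s±T≢0 s²≡N)) root₁
          (square-roots (Equivalence.from (root-relation⇔on-circle _ s²≡N radius₂) on-C₂))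

      tangent⇒centres-related : r₁ ≢ 0# → Tangent (B¹ c₁ r₁) (B¹ c₂ r₂) → CentresRelated c₁ c₂
      tangent⇒centres-related r₁≢0 (_ , nothing , (() , _) , _)
      tangent⇒centres-related r₁≢0 (_ , just z , (z∈C₁ , z∈C₂) , unique) =
        real-common-point⇒centres-related r₁≢0 z-real
        (Equivalence.to (on-real-circle-at-real-point c₁-real z-real) z∈C₁)
        (Equivalence.to (on-real-circle-at-real-point c₂-real z-real) z∈C₂)
        where
        z-real : InGFq z
        z-real = Maybe.just-injective
          (unique (just (bar z)) (real-circle-bar-closed c₁-real z∈C₁) (real-circle-bar-closed c₂-real z∈C₂))

      centres-related⇒tangent : Distinct (B¹ c₁ r₁) (B¹ c₂ r₂) → CentresRelated c₁ c₂ →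
        Tangent (B¹ c₁ r₁) (B¹ c₂ r₂)
      centres-related⇒tangent distinct (s , s-real , s²≡N , related) =
        distinct , just z , (z∈C₁ , z∈C₂) , unique
        where
        s≢0 : s ≢ 0#
        s≢0 s≡0 = N≢0 (trans (sym s²≡N) (trans (cong (_* s) s≡0) (zeroˡ s)))

        2s≢0 : 2# * s ≢ 0#
        2s≢0 = *-≢0 (2≢0 p≢2) s≢0

        z : F
        z = c₁ + c₁ * T * (2# * s) ⁻¹

        z-real : InGFq z
        z-real = real-+ c₁-real (real-* (real-* c₁-real T-real) (real-⁻¹ 2s≢0 (real-* bar-2 s-real)))

        root₁ : s * (2# * (z - c₁)) ≡ c₁ * T
        root₁ = trans identity (*-⁻¹-cancelʳ (c₁ * T) 2s≢0)
          where
          identity : s * (2# * (z - c₁)) ≡ c₁ * T * (2# * s) ⁻¹ * (2# * s)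
          identity = solve 3 (λ s c₁ w → s :* (con (ℤ.+ 2) :* ((c₁ :+ w) :- c₁)) := w :* (con (ℤ.+ 2) :* s))
            refl s c₁ (c₁ * T * (2# * s) ⁻¹)

        root₂ : s * (2# * (z - c₂)) ≡ - (c₂ * T)
        root₂ = x-y≡0⇒x≡y (trans certificate (zero-combination₂ _ _ (x≡y⇒x-y≡0 root₁) (x≡y⇒x-y≡0 related)))
          where
          certificate : s * (2# * (z - c₂)) - - (c₂ * T)
            ≡ 1# * (s * (2# * (z - c₁)) - c₁ * T) + (- 1#) * (c₂ * (2# * s - T) - c₁ * (2# * s + T))
          certificate = solve 5 (λ z s T c₁ c₂ → let 2# = con (ℤ.+ 2) in
            s :* (2# :* (z :- c₂)) :- :- (c₂ :* T)
            := con (ℤ.+ 1) :* (s :* (2# :* (z :- c₁)) :- c₁ :* T)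
               :+ (:- con (ℤ.+ 1)) :* (c₂ :* (2# :* s :- T) :- c₁ :* (2# :* s :+ T)))
            refl z s T c₁ c₂

        z∈C₁ : B¹ c₁ r₁ (just z)
        z∈C₁ = Equivalence.from (on-real-circle-at-real-point c₁-real z-real)
          (Equivalence.to (root-relation⇔on-circle (z - c₁) s²≡N radius₁) (cong (λ w → w * w) root₁))

        z∈C₂ : B¹ c₂ r₂ (just z)
        z∈C₂ = Equivalence.from (on-real-circle-at-real-point c₂-real z-real)
          (Equivalence.to (root-relation⇔on-circle (z - c₂) s²≡N radius₂)
            (trans (cong (λ w → w * w) root₂) (solve 1 (λ x → (:- x) :* (:- x) := x :* x) refl (c₂ * T))))

        unique : ∀ Q → B¹ c₁ r₁ Q → B¹ c₂ r₂ Q → Q ≡ just z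
        unique nothing  ()
        unique (just y) y∈C₁ y∈C₂ =
          cong just (real-centres-meet-once c₁-real c₂-real c₁≢c₂ z-real z∈C₁ z∈C₂ y∈C₁ y∈C₂)

    centres-related⇔quotient : ∀ {c₁ c₂} → CentresRelated c₁ c₂ ⇔
      Σ F (λ s → InGFq s × s * s ≡ N ×
        (c₂ ≡ c₁ * ((2# * s + T) * (2# * s - T) ⁻¹) ⊎ c₂ ≡ c₁ * ((2# * s - T) * (2# * s + T) ⁻¹)))
    centres-related⇔quotient {c₁} {c₂} = mk⇔
      (λ (s , s-real , s²≡N , related) →
        s , s-real , s²≡N , inj₁ (cross-multiplied⇒quotient (proj₁ (2s±T≢0 s²≡N)) related))
      (λ where
        (s , s-real , s²≡N , inj₁ quotient) →
          s , s-real , s²≡N , quotient⇒cross-multiplied (proj₁ (2s±T≢0 s²≡N)) quotient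
        (s , s-real , s²≡N , inj₂ quotient) →
          - s , trans (bar-‿ s) (cong -_ s-real) ,
          trans (solve 1 (λ s → (:- s) :* (:- s) := s :* s) refl s) s²≡N ,
          negated-root (quotient⇒cross-multiplied (proj₂ (2s±T≢0 s²≡N)) quotient))
      where
      negated-root : ∀ {s} → c₂ * (2# * s + T) ≡ c₁ * (2# * s - T) →
        c₂ * (2# * (- s) - T) ≡ c₁ * (2# * (- s) + T)
      negated-root {s} related = begin
        c₂ * (2# * (- s) - T)        ≡⟨ solve 3 (λ c s T → let 2# = con (ℤ.+ 2) in
                                          c :* (2# :* (:- s) :- T) := :- (c :* (2# :* s :+ T))) refl c₂ s T ⟩
        - (c₂ * (2# * s + T))        ≡⟨ cong -_ related ⟩
        - (c₁ * (2# * s - T))        ≡⟨ solve 3 (λ c s T → let 2# = con (ℤ.+ 2) in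
                                          :- (c :* (2# :* s :- T)) := c :* (2# :* (:- s) :+ T)) refl c₁ s T ⟩
        c₁ * (2# * (- s) + T)        ∎
        where open ≡-Reasoning

open import Data.Product using (Σ; _×_; _,_)
open import Data.Sum using (_⊎_)
open import Relation.Binary.PropositionalEquality using (sym)
open import Function.Bundles using (_⇔_; mk⇔)
open import Function.Construct.Composition using (_⇔-∘_)

lemma4p3 : (p m : ℕ) → Prime p → ¬ (p ≡ 2) → m ≥ 1 →
    (K : FiniteField ((p ^ m) ^ 2)) →
    let open Plane (p ^ m) K in
    (γ : F) → ¬ (pow γ 2 ≡ pow (bar γ) 2) →
    (c₁ r₁ c₂ r₂ : F) →
    IsFirstType c₁ r₁ → IsFirstType c₂ r₂ →
    Distinct (B¹ c₁ r₁) (B¹ c₂ r₂) →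
    Tangent (B¹ c₁ r₁) (B² γ 0#) → Tangent (B¹ c₁ r₁) (B² (bar γ) 0#) →
    Tangent (B¹ c₂ r₂) (B² γ 0#) → Tangent (B¹ c₂ r₂) (B² (bar γ) 0#) →
    c₁ ≡ bar c₁ → c₂ ≡ bar c₂ →
    (Tangent (B¹ c₁ r₁) (B¹ c₂ r₂) ⇔
      Σ F (λ s → InGFq s × s * s ≡ γ * bar γ ×
        (c₂ ≡ c₁ * ((2# * s + (γ + bar γ)) * (2# * s - (γ + bar γ)) ⁻¹)
         ⊎ c₂ ≡ c₁ * ((2# * s - (γ + bar γ)) * (2# * s + (γ + bar γ)) ⁻¹))))
-- Tangency to the conjugate line B²(γ̄,0) is the conjugate of tangency to B²(γ,0) (the
-- centres are real), so it carries no extra information.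
lemma4p3 p m p-prime p≢2 _ K γ γ²≢γ̄² c₁ r₁ c₂ r₂ (_ , r₁≢0) _ distinct line₁ _ line₂ _ c₁≡c̄₁ c₂≡c̄₂ =
  centres-related⇔quotient ⇔-∘ mk⇔ (tangent⇒centres-related r₁≢0) (centres-related⇒tangent distinct)
  where
  open FiniteField K using (_*_; 2#)
  open Geometry p m p-prime p≢2 K
  open Tangency γ γ²≢γ̄²

  radius₁ : (2# * 2#) * N * r₁ ≡ c₁ * c₁ * (T * T)
  radius₁ = tangent⇒radius (sym c₁≡c̄₁) line₁

  radius₂ : (2# * 2#) * N * r₂ ≡ c₂ * c₂ * (T * T)
  radius₂ = tangent⇒radius (sym c₂≡c̄₂) line₂

  open TwoCircles (sym c₁≡c̄₁) (sym c₂≡c̄₂) (centres-distinct radius₁ radius₂ distinct) radius₁ radius₂
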